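{- Let $S$ be a numerical semigroup with minimal generators $a_1<a_2<\cdots<a_\nu$, multiplicity $\mu=a_1$ and conductor $c$, and suppose $a_2>\frac{c+\mu}{3}$. Let $P=\{a_1,\ldots,a_\nu\}$, $q_1=|\{a\in P\setminus\{\mu\}\mid \frac{c+\mu}{3}<a<\frac{c+\mu}{2}\}|$ and $q_2=|\{a\in P\setminus\{\mu\}\mid \frac{c+\mu}{2}\le a<\frac{2}{3}(c+\mu)\}|$. Then $$|L(S)|\ge\left\lfloor\frac{c}{\mu}\right\rfloor+\left(\left\lfloor\frac12\frac{c}{\mu}-\frac12\right\rfloor+1\right)q_1+\left(\left\lfloor\frac13\frac{c}{\mu}-\frac23\right\rfloor+1\right)q_2.$$
   Context: A numerical semigroup is a subset $S\subseteq\mathbb{N}$ containing $0$, closed under addition, with $\mathbb{N}\setminus S$ finite. Its conductor $c=c(S)$ is the least integer $x$ with $x+\mathbb{N}\subseteq S$. $S$ has a unique minimal set of generators; its cardinality is the embedding dimension $\nu(S)$ and its least element is the multiplicity $\mu(S)$. $L(S)=\{x\in S\mid 0\le x<c(S)\}$. -}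

module Defs where

open import Data.Nat using (ℕ; zero; suc; _+_; _*_; _∸_; _≤_; _<_; _≤ᵇ_; _<ᵇ_; _≡ᵇ_)
open import Data.Bool using (Bool; true; false; _∧_; not; if_then_else_)
open import Data.List using (List; upTo)
open import Data.Bool.ListAction using (any)
open import Data.Product using (Σ; _×_)
open import Relation.Binary.PropositionalEquality using (_≡_; _≢_)
open import Data.Integer as ℤ using (ℤ)

record NumericalSemigroup : Set where
  field
    mem      : ℕ → Bool
    mem-zero : mem 0 ≡ true
    mem-add  : ∀ x y → mem x ≡ true → mem y ≡ true → mem (x + y) ≡ true
    cofinite : Σ ℕ λ N → ∀ n → N ≤ n → mem n ≡ true
open NumericalSemigroup public

_∈S_ : ℕ → NumericalSemigroup → Set
x ∈S S = mem S x ≡ true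

IsConductor : NumericalSemigroup → ℕ → Set
IsConductor S c =
  (∀ y → c ≤ y → y ∈S S) × (∀ x → (∀ y → x ≤ y → y ∈S S) → c ≤ x)

IsMultiplicity : NumericalSemigroup → ℕ → Set
IsMultiplicity S μ = (μ ≢ 0) × (μ ∈S S) × (∀ x → x ≢ 0 → x ∈S S → μ ≤ x)

-- Minimal generators of S: the nonzero elements of S that are not a
-- sum of two nonzero elements of S (i.e. S* \ (S* + S*)), which is the
-- unique minimal system of generators of S.
isMinGen : NumericalSemigroup → ℕ → Bool
isMinGen S a =
  mem S a ∧ not (a ≡ᵇ 0) ∧
  not (any (λ x → not (x ≡ᵇ 0) ∧ mem S x ∧ mem S (a ∸ x)) (upTo a))

countBelow : (ℕ → Bool) → ℕ → ℕ
countBelow p zero = zero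
countBelow p (suc n) = (if p n then 1 else 0) + countBelow p n

-- |L(S)| = |{x ∈ S | 0 ≤ x < c}|
cardL : NumericalSemigroup → ℕ → ℕ
cardL S c = countBelow (mem S) c

-- q₁ = |{a ∈ P \ {μ} | (c+μ)/3 < a < (c+μ)/2}|
-- (all such a are < c+μ, so counting below c+μ is exhaustive)
q₁ : NumericalSemigroup → ℕ → ℕ → ℕ
q₁ S c μ = countBelow
  (λ a → isMinGen S a ∧ not (a ≡ᵇ μ) ∧ ((c + μ) <ᵇ 3 * a) ∧ (2 * a <ᵇ c + μ))
  (c + μ)

q₂ : NumericalSemigroup → ℕ → ℕ → ℕ
q₂ S c μ = countBelow
  (λ a → isMinGen S a ∧ not (a ≡ᵇ μ) ∧ ((c + μ) ≤ᵇ 2 * a) ∧ (3 * a <ᵇ 2 * (c + μ)))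
  (c + μ)

-- ⌊ z / d ⌋ for integer z and natural d ≥ 1 (value 0 for d = 0, unused).
⌊_/_⌋ : ℤ → ℕ → ℤ
⌊ z / zero ⌋ = ℤ.0ℤ
⌊ z / suc d ⌋ = z ℤ./ℕ suc d

module Submission where

-- Split S ∩ [0, c) according to residues modulo μ and bound
-- each residue class r separately by
--     T₀(r) + M₁·A(r) + M₂·B(r),      M₁ = ⌊(c+μ)/2μ⌋,  M₂ = ⌊(c+μ)/3μ⌋,
-- where T₀(0) = ⌊c/μ⌋ (and T₀(r) = 0 otherwise) and A(r), B(r) count the
-- minimal generators ≠ μ of residue r counted by q₁, q₂ respectively.
-- * Class 0 contains 0, μ, …, (⌊c/μ⌋-1)μ, all below c.
-- * Two distinct minimal generators never share a residue (the larger one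
--   would be the smaller one plus a multiple of μ), and no generator ≠ μ
--   has residue 0.  So each class carries at most one of the three terms.
-- * A generator g with 2g < c+μ (resp. 3g < 2(c+μ)) stays below c when M₁
--   (resp. M₂) steps of size μ are added, and these translates lie in S.
-- Summing over the classes r < μ gives |L(S)| ≥ ⌊c/μ⌋ + M₁q₁ + M₂q₂, and the
-- integer floors of the statement are rewritten as M₁ and M₂.  (The counting
-- argument does not need the hypothesis a₂ > (c+μ)/3.)

open import Defs
open import Data.Nat as ℕ
  using (ℕ; zero; suc; _+_; _*_; _∸_; _≤_; _<_; z≤n; s≤s; z<s; _≡ᵇ_; _<ᵇ_; _≤ᵇ_; NonZero; >-nonZero⁻¹)
open import Data.Nat.Properties
open import Data.Nat.DivMod
open import Data.Nat.Divisibility using (∣-refl)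
open import Data.Nat.Solver using (module +-*-Solver)
open import Algebra.Properties.CommutativeSemigroup +-commutativeSemigroup using (interchange)
open import Data.Bool using (Bool; true; false; _∧_; not; if_then_else_; T)
open import Data.Bool.Properties using (∧-conicalˡ; ∧-conicalʳ; not-injective)
open import Data.List using (upTo)
open import Data.Bool.ListAction using (any)
open import Data.List.Membership.Propositional using (lose)
open import Data.List.Membership.Propositional.Properties using (∈-upTo⁺)
open import Data.List.Relation.Unary.Any.Properties using (any⁺)
open import Data.Product using (Σ; _×_; _,_; proj₁; proj₂)
open import Data.Sum as Sum using (_⊎_; inj₁; inj₂)
open import Data.Empty using (⊥; ⊥-elim)
open import Relation.Binary.PropositionalEquality
open import Relation.Nullary using (yes; no)
open import Relation.Binary.Definitions using (tri<; tri≈; tri>)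
open import Data.Integer as ℤ using (+_; -[1+_]; _-_; _⊖_; +≤+)
open import Data.Integer.Properties as ℤP using (⊖-≥; ⊖-<; pos-*)
open import Data.Integer using () renaming (_≥_ to _≥ℤ_)
open import Data.Integer using () renaming (_+_ to _+ℤ_; _*_ to _*ℤ_)

true⇒T : ∀ {b} → b ≡ true → T b
true⇒T refl = _

T⇒true : ∀ {b} → T b → b ≡ true
T⇒true {true} _ = refl

≢-from-test : ∀ a b → not (a ≡ᵇ b) ≡ true → a ≢ b
≢-from-test a b a≠b refl = subst T (not-injective {y = false} a≠b) (≡⇒≡ᵇ a a refl)

floor-small-negative : ∀ n d → suc n < suc d → -[1+ n ] ℤ./ℕ suc d ≡ -[1+ 0 ]
floor-small-negative n d lt rewrite m<n⇒m%n≡m lt | m<n⇒m/n≡0 lt = refl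

-- ⌊(c - e)/d⌋ + 1 = ⌊(c + (d - e))/d⌋ for 0 ≤ e < d; this turns the integer
-- floors of the statement into quotients of natural numbers.
floor-minus-plus-one : ∀ c e d → e < suc d →
  ⌊ (+ c - + e) / suc d ⌋ +ℤ + 1 ≡ + ((c + (suc d ∸ e)) / suc d)
floor-minus-plus-one c e d e<d with e ℕ.≤? c
... | yes e≤c = begin
  ⌊ (+ c - + e) / suc d ⌋ +ℤ + 1        ≡⟨ cong (λ z → ⌊ z / suc d ⌋ +ℤ + 1) (ℤP.m-n≡m⊖n c e) ⟩
  ⌊ (c ⊖ e) / suc d ⌋ +ℤ + 1            ≡⟨ cong (λ z → ⌊ z / suc d ⌋ +ℤ + 1) (⊖-≥ e≤c) ⟩
  + ((c ∸ e) / suc d + 1)              ≡⟨ cong (λ z → + ((c ∸ e) / suc d + z)) (sym (n/n≡1 (suc d))) ⟩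
  + ((c ∸ e) / suc d + suc d / suc d)  ≡⟨ cong +_ (sym (+-distrib-/-∣ʳ (c ∸ e) ∣-refl)) ⟩
  + (((c ∸ e) + suc d) / suc d)        ≡⟨ cong (λ z → + (z / suc d)) shift ⟩
  + ((c + (suc d ∸ e)) / suc d)        ∎
  where
  open ≡-Reasoning
  shift : (c ∸ e) + suc d ≡ c + (suc d ∸ e)
  shift = trans (sym (+-∸-comm (suc d) e≤c)) (+-∸-assoc c (<⇒≤ e<d))
... | no e≰c with e ∸ c in e∸c
...   | zero = ⊥-elim (e≰c (m∸n≡0⇒m≤n e∸c))
...   | suc k = begin
  ⌊ (+ c - + e) / suc d ⌋ +ℤ + 1   ≡⟨ cong (λ z → ⌊ z / suc d ⌋ +ℤ + 1) (ℤP.m-n≡m⊖n c e) ⟩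
  ⌊ (c ⊖ e) / suc d ⌋ +ℤ + 1       ≡⟨ cong (λ z → ⌊ z / suc d ⌋ +ℤ + 1) c⊖e ⟩
  -[1+ k ] ℤ./ℕ suc d +ℤ + 1       ≡⟨ cong (_+ℤ + 1) (floor-small-negative k d k<d) ⟩
  + 0                             ≡⟨ cong +_ (sym (m<n⇒m/n≡0 small)) ⟩
  + ((c + (suc d ∸ e)) / suc d)   ∎
  where
  open ≡-Reasoning
  c⊖e : c ⊖ e ≡ -[1+ k ]
  c⊖e = trans (⊖-< (≰⇒> e≰c)) (cong (λ z → ℤ.- (+ z)) e∸c)
  k<d : suc k < suc d
  k<d = ≤-<-trans (subst (_≤ e) e∸c (m∸n≤m e c)) e<d
  small : c + (suc d ∸ e) < suc d
  small = subst (c + (suc d ∸ e) <_) (m+[n∸m]≡n (<⇒≤ e<d)) (+-monoˡ-< (suc d ∸ e) (≰⇒> e≰c))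

⦅_⦆ : Bool → ℕ
⦅ b ⦆ = if b then 1 else 0

count-mono : ∀ p {m n} → m ≤ n → countBelow p m ≤ countBelow p n
count-mono p {m} {zero} z≤n = z≤n
count-mono p {m} {suc n} m≤1+n with m ℕ.≟ suc n
... | yes refl = ≤-refl
... | no m≢1+n = ≤-trans (count-mono p (m<1+n⇒m≤n (≤∧≢⇒< m≤1+n m≢1+n))) (m≤n+m _ ⦅ p n ⦆)

count-progression : ∀ μ .{{_ : NonZero μ}} p g K n →
  (∀ k → k < K → p (g + k * μ) ≡ true) → (∀ k → k < K → g + k * μ < n) →
  K ≤ countBelow p n
count-progression μ p g zero n holds below = z≤n
count-progression μ p g (suc K) n holds below = begin
  suc K                               ≤⟨ s≤s (count-progression μ p g K last holds′ below′) ⟩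
  suc (countBelow p last)             ≡⟨ cong (λ b → ⦅ b ⦆ + countBelow p last) (sym (holds K ≤-refl)) ⟩
  countBelow p (suc last)             ≤⟨ count-mono p (below K ≤-refl) ⟩
  countBelow p n                      ∎
  where
  open ≤-Reasoning
  last = g + K * μ
  holds′ : ∀ k → k < K → p (g + k * μ) ≡ true
  holds′ k k<K = holds k (m<n⇒m<1+n k<K)
  below′ : ∀ k → k < K → g + k * μ < last
  below′ k k<K = +-monoʳ-< g (*-monoˡ-< μ k<K)

count-none : ∀ p n → (∀ x → x < n → p x ≡ true → ⊥) → countBelow p n ≡ 0
count-none p zero none = refl
count-none p (suc n) none with p n in pn
... | true = ⊥-elim (none n ≤-refl pn)
... | false = count-none p n (λ x x<n → none x (m<n⇒m<1+n x<n))

count-witness : ∀ p n → (Σ ℕ λ x → x < n × p x ≡ true) ⊎ (countBelow p n ≡ 0)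
count-witness p zero = inj₂ refl
count-witness p (suc n) with p n in pn
... | true = inj₁ (n , ≤-refl , pn)
... | false with count-witness p n
...   | inj₁ (x , x<n , px) = inj₁ (x , m<n⇒m<1+n x<n , px)
...   | inj₂ none = inj₂ none

count-unique : ∀ p n → (∀ x y → x < n → y < n → p x ≡ true → p y ≡ true → x ≡ y) →
  countBelow p n ≤ 1
count-unique p zero unique = z≤n
count-unique p (suc n) unique with p n in pn
... | true = ≤-reflexive (cong suc (count-none p n λ x x<n px →
               <-irrefl (unique x n (m<n⇒m<1+n x<n) ≤-refl px pn) x<n))
... | false = count-unique p n λ x y x<n y<n → unique x y (m<n⇒m<1+n x<n) (m<n⇒m<1+n y<n)

sumBelow : (ℕ → ℕ) → ℕ → ℕ
sumBelow f zero = 0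
sumBelow f (suc n) = f n + sumBelow f n

sumBelow-mono : ∀ f g n → (∀ r → r < n → f r ≤ g r) → sumBelow f n ≤ sumBelow g n
sumBelow-mono f g zero f≤g = z≤n
sumBelow-mono f g (suc n) f≤g =
  +-mono-≤ (f≤g n ≤-refl) (sumBelow-mono f g n λ r r<n → f≤g r (m<n⇒m<1+n r<n))

sumBelow-zero : ∀ f n → (∀ r → r < n → f r ≡ 0) → sumBelow f n ≡ 0
sumBelow-zero f zero f≡0 = refl
sumBelow-zero f (suc n) f≡0 rewrite f≡0 n ≤-refl =
  sumBelow-zero f n λ r r<n → f≡0 r (m<n⇒m<1+n r<n)

sumBelow-+ : ∀ f g n → sumBelow (λ r → f r + g r) n ≡ sumBelow f n + sumBelow g n
sumBelow-+ f g zero = refl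
sumBelow-+ f g (suc n) rewrite sumBelow-+ f g n = interchange (f n) (g n) (sumBelow f n) (sumBelow g n)

sumBelow-* : ∀ k f n → sumBelow (λ r → k * f r) n ≡ k * sumBelow f n
sumBelow-* k f zero = sym (*-zeroʳ k)
sumBelow-* k f (suc n) rewrite sumBelow-* k f n = sym (*-distribˡ-+ k (f n) (sumBelow f n))

sumBelow-linear : ∀ f g h a b n →
  sumBelow (λ r → f r + a * g r + b * h r) n ≡ sumBelow f n + a * sumBelow g n + b * sumBelow h n
sumBelow-linear f g h a b n = begin
  sumBelow (λ r → f r + a * g r + b * h r) n
    ≡⟨ sumBelow-+ (λ r → f r + a * g r) (λ r → b * h r) n ⟩
  sumBelow (λ r → f r + a * g r) n + sumBelow (λ r → b * h r) n
    ≡⟨ cong₂ _+_ (sumBelow-+ f (λ r → a * g r) n) (sumBelow-* b h n) ⟩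
  sumBelow f n + sumBelow (λ r → a * g r) n + b * sumBelow h n
    ≡⟨ cong (λ z → sumBelow f n + z + b * sumBelow h n) (sumBelow-* a g n) ⟩
  sumBelow f n + a * sumBelow g n + b * sumBelow h n ∎
  where open ≡-Reasoning

sumBelow-at-zero : ∀ K n → sumBelow (λ r → if r ≡ᵇ 0 then K else 0) (suc n) ≡ K
sumBelow-at-zero K zero = +-identityʳ K
sumBelow-at-zero K (suc n) = sumBelow-at-zero K n

indicator-≢ : ∀ t r → t ≢ r → ⦅ t ≡ᵇ r ⦆ ≡ 0
indicator-≢ t r t≢r with t ≡ᵇ r in t≡ᵇr
... | false = refl
... | true = ⊥-elim (t≢r (≡ᵇ⇒≡ t r (true⇒T t≡ᵇr)))

sumBelow-indicator : ∀ t n → t < n → sumBelow (λ r → ⦅ t ≡ᵇ r ⦆) n ≡ 1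
sumBelow-indicator t (suc n) t<1+n with t ℕ.≟ n
... | yes refl rewrite T⇒true (≡⇒≡ᵇ t t refl) =
  cong suc (sumBelow-zero _ t λ r r<t → indicator-≢ t r (≢-sym (<⇒≢ r<t)))
... | no t≢n = trans (cong (_+ sumBelow _ n) (indicator-≢ t n t≢n))
                     (sumBelow-indicator t n (≤∧≢⇒< (m<1+n⇒m≤n t<1+n) t≢n))

count-by-residue : ∀ μ .{{_ : NonZero μ}} p n →
  countBelow p n ≡ sumBelow (λ r → countBelow (λ x → p x ∧ (x % μ ≡ᵇ r)) n) μ
count-by-residue μ p zero = sym (sumBelow-zero _ μ λ _ _ → refl)
count-by-residue μ p (suc n) = begin
  ⦅ p n ⦆ + countBelow p n
    ≡⟨ cong₂ _+_ split-indicator (count-by-residue μ p n) ⟩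
  sumBelow (λ r → ⦅ p n ∧ (n % μ ≡ᵇ r) ⦆) μ + sumBelow (λ r → countBelow (λ x → p x ∧ (x % μ ≡ᵇ r)) n) μ
    ≡⟨ sym (sumBelow-+ _ _ μ) ⟩
  sumBelow (λ r → countBelow (λ x → p x ∧ (x % μ ≡ᵇ r)) (suc n)) μ ∎
  where
  open ≡-Reasoning
  split-indicator : ⦅ p n ⦆ ≡ sumBelow (λ r → ⦅ p n ∧ (n % μ ≡ᵇ r) ⦆) μ
  split-indicator with p n
  ... | true = sym (sumBelow-indicator (n % μ) μ (m%n<n n μ))
  ... | false = sym (sumBelow-zero _ μ λ _ _ → refl)

exclusive-sum-≤ : ∀ {x y z w} → x ≤ w → y ≤ w → z ≤ w →
  x ≡ 0 ⊎ (y ≡ 0 × z ≡ 0) → y ≡ 0 ⊎ z ≡ 0 → x + y + z ≤ w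
exclusive-sum-≤ {x} x≤w _ _ (inj₂ (refl , refl)) _ =
  subst (_≤ _) (sym (trans (+-identityʳ (x + 0)) (+-identityʳ x))) x≤w
exclusive-sum-≤ {y = y} _ y≤w _ (inj₁ refl) (inj₂ refl) = subst (_≤ _) (sym (+-identityʳ y)) y≤w
exclusive-sum-≤ _ _ z≤w (inj₁ refl) (inj₁ refl) = z≤w

multiple-below : ∀ c μ .{{_ : NonZero μ}} k → k < c / μ → k * μ < c
multiple-below c μ k k<c/μ = begin-strict
  k * μ        <⟨ m<n+m (k * μ) (>-nonZero⁻¹ μ) ⟩
  suc k * μ    ≤⟨ *-monoˡ-≤ μ k<c/μ ⟩
  (c / μ) * μ  ≤⟨ m/n*n≤m c μ ⟩
  c            ∎
  where open ≤-Reasoning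

-- If (n+1)g < n(c+μ), then g + kμ < c for all k < ⌊(c+μ)/((n+1)μ)⌋:
-- (n+1)(g + kμ) + (n+1)μ ≤ (n+1)g + (c+μ) < (n+1)(c+μ).
progression-below : ∀ n c m g k → let μ = suc m in
  suc n * g < n * (c + μ) → k < (c + μ) / (suc n * μ) → g + k * μ < c
progression-below n c m g k g-small k<M =
  *-cancelˡ-< (suc n) _ _ (+-cancelʳ-≤ (suc n * μ) _ _ (subst₂ _≤_ lhs rhs total))
  where
  open +-*-Solver
  μ = suc m
  steps : suc k * (suc n * μ) ≤ c + μ
  steps = ≤-trans (*-monoˡ-≤ (suc n * μ) k<M) (m/n*n≤m (c + μ) (suc n * μ))
  total : suc (suc n * g) + suc k * (suc n * μ) ≤ n * (c + μ) + (c + μ)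
  total = +-mono-≤ g-small steps
  lhs : suc (suc n * g) + suc k * (suc n * μ) ≡ suc (suc n * (g + k * μ)) + suc n * μ
  lhs = solve 4 (λ n g k μ → (con 1 :+ (con 1 :+ n) :* g) :+ (con 1 :+ k) :* ((con 1 :+ n) :* μ)
                 := (con 1 :+ (con 1 :+ n) :* (g :+ k :* μ)) :+ (con 1 :+ n) :* μ) refl n g k μ
  rhs : n * (c + μ) + (c + μ) ≡ suc n * c + suc n * μ
  rhs = solve 3 (λ n c μ → n :* (c :+ μ) :+ (c :+ μ) := (con 1 :+ n) :* c :+ (con 1 :+ n) :* μ) refl n c μ

module _ (S : NumericalSemigroup) where

  multiple-∈S : ∀ a → a ∈S S → ∀ k → (k * a) ∈S S
  multiple-∈S a a∈S zero = mem-zero S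
  multiple-∈S a a∈S (suc k) = mem-add S a (k * a) a∈S (multiple-∈S a a∈S k)

  minGen-∈S : ∀ a → isMinGen S a ≡ true → a ∈S S
  minGen-∈S a gen = ∧-conicalˡ _ _ gen

  minGen-pos : ∀ a → isMinGen S a ≡ true → 0 < a
  minGen-pos zero gen with mem S 0 | gen
  ... | true | ()
  ... | false | ()
  minGen-pos (suc a) gen = z<s

  minGen-irreducible : ∀ a x → isMinGen S a ≡ true → 0 < x → x < a → x ∈S S → (a ∸ x) ∈S S → ⊥
  minGen-irreducible a (suc x) gen _ x<a x∈S rest∈S =
    subst T no-split (any⁺ splits (lose (∈-upTo⁺ x<a) split))
    where
    splits : ℕ → Bool
    splits y = not (y ≡ᵇ 0) ∧ mem S y ∧ mem S (a ∸ y)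
    no-split : any splits (upTo a) ≡ false
    no-split = not-injective {y = false} (∧-conicalʳ (not (a ≡ᵇ 0)) _ (∧-conicalʳ (mem S a) _ gen))
    split : T (splits (suc x))
    split rewrite x∈S | rest∈S = _

  module _ (μ : ℕ) .{{_ : NonZero μ}} (μ∈S : μ ∈S S) where

    -- No nonzero x ∈ S below a minimal generator g is congruent to g mod μ:
    -- otherwise g = x + (g - x) with g - x a multiple of μ.
    congruent-below-minGen : ∀ x g → isMinGen S g ≡ true → x ∈S S → 0 < x → x < g →
      x % μ ≡ g % μ → ⊥
    congruent-below-minGen x g gen x∈S x>0 x<g same =
      minGen-irreducible g x gen x>0 x<g x∈S (subst (_∈S S) (sym difference) (multiple-∈S μ μ∈S (g / μ ∸ x / μ)))
      where
      open ≡-Reasoning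
      difference : g ∸ x ≡ (g / μ ∸ x / μ) * μ
      difference = begin
        g ∸ x                                        ≡⟨ cong₂ _∸_ (m≡m%n+[m/n]*n g μ) (m≡m%n+[m/n]*n x μ) ⟩
        (g % μ + (g / μ) * μ) ∸ (x % μ + (x / μ) * μ) ≡⟨ cong (λ z → (g % μ + (g / μ) * μ) ∸ (z + (x / μ) * μ)) same ⟩
        (g % μ + (g / μ) * μ) ∸ (g % μ + (x / μ) * μ) ≡⟨ [m+n]∸[m+o]≡n∸o (g % μ) _ _ ⟩
        (g / μ) * μ ∸ (x / μ) * μ                    ≡⟨ sym (*-distribʳ-∸ μ (g / μ) (x / μ)) ⟩
        (g / μ ∸ x / μ) * μ                          ∎

    minGen-residue-injective : ∀ g g′ → isMinGen S g ≡ true → isMinGen S g′ ≡ true →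
      g % μ ≡ g′ % μ → g ≡ g′
    minGen-residue-injective g g′ gen gen′ same with <-cmp g g′
    ... | tri< g<g′ _ _ = ⊥-elim (congruent-below-minGen g g′ gen′ (minGen-∈S g gen) (minGen-pos g gen) g<g′ same)
    ... | tri≈ _ g≡g′ _ = g≡g′
    ... | tri> _ _ g′<g = ⊥-elim (congruent-below-minGen g′ g gen (minGen-∈S g′ gen′) (minGen-pos g′ gen′) g′<g (sym same))

    minGen-residue-nonzero : (∀ x → x ≢ 0 → x ∈S S → μ ≤ x) →
      ∀ g → isMinGen S g ≡ true → g ≢ μ → g % μ ≡ 0 → ⊥
    minGen-residue-nonzero μ-least g gen g≢μ g%μ≡0 =
      congruent-below-minGen μ g gen μ∈S (>-nonZero⁻¹ μ) μ<g (trans (n%n≡0 μ) (sym g%μ≡0))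
      where
      μ<g : μ < g
      μ<g = ≤∧≢⇒< (μ-least g (≢-sym (<⇒≢ (minGen-pos g gen))) (minGen-∈S g gen)) (≢-sym g≢μ)

module ResidueClasses (S : NumericalSemigroup) (c m : ℕ) (multiplicity : IsMultiplicity S (suc m)) where

  μ : ℕ
  μ = suc m

  μ∈S : μ ∈S S
  μ∈S = proj₁ (proj₂ multiplicity)

  inClass : ℕ → ℕ → Bool
  inClass r x = x % μ ≡ᵇ r

  lower upper : ℕ → Bool
  lower a = isMinGen S a ∧ not (a ≡ᵇ μ) ∧ ((c + μ) <ᵇ 3 * a) ∧ (2 * a <ᵇ c + μ)
  upper a = isMinGen S a ∧ not (a ≡ᵇ μ) ∧ ((c + μ) ≤ᵇ 2 * a) ∧ (3 * a <ᵇ 2 * (c + μ))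

  T₀ A B C : ℕ → ℕ
  T₀ r = if r ≡ᵇ 0 then c / μ else 0
  A r = countBelow (λ a → lower a ∧ inClass r a) (c + μ)
  B r = countBelow (λ a → upper a ∧ inClass r a) (c + μ)
  C r = countBelow (λ x → mem S x ∧ inClass r x) c

  M₁ M₂ : ℕ
  M₁ = (c + μ) / (2 * μ)
  M₂ = (c + μ) / (3 * μ)

  record GeneratorOfClass (a r : ℕ) : Set where
    field
      minGen  : isMinGen S a ≡ true
      ≢μ      : a ≢ μ
      residue : a % μ ≡ r
  open GeneratorOfClass

  decode : ∀ a r rest → ((isMinGen S a ∧ not (a ≡ᵇ μ) ∧ rest) ∧ inClass r a) ≡ true →
    GeneratorOfClass a r × rest ≡ true
  decode a r rest e =
    record { minGen = gen ; ≢μ = ≢-from-test a μ a≠μ ; residue = ≡ᵇ⇒≡ _ _ (true⇒T in-r) } , rest≡true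
    where
    tests : (isMinGen S a ∧ not (a ≡ᵇ μ) ∧ rest) ≡ true
    tests = ∧-conicalˡ _ (inClass r a) e
    in-r : inClass r a ≡ true
    in-r = ∧-conicalʳ (isMinGen S a ∧ not (a ≡ᵇ μ) ∧ rest) _ e
    gen : isMinGen S a ≡ true
    gen = ∧-conicalˡ _ _ tests
    a≠μ : not (a ≡ᵇ μ) ≡ true
    a≠μ = ∧-conicalˡ _ rest (∧-conicalʳ (isMinGen S a) _ tests)
    rest≡true : rest ≡ true
    rest≡true = ∧-conicalʳ (not (a ≡ᵇ μ)) _ (∧-conicalʳ (isMinGen S a) _ tests)

  decode-lower : ∀ a r → (lower a ∧ inClass r a) ≡ true → GeneratorOfClass a r × 2 * a < c + μ
  decode-lower a r e with decode a r _ e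
  ... | gen , bounds = gen , <ᵇ⇒< _ _ (true⇒T (∧-conicalʳ ((c + μ) <ᵇ 3 * a) _ bounds))

  decode-upper : ∀ a r → (upper a ∧ inClass r a) ≡ true →
    GeneratorOfClass a r × c + μ ≤ 2 * a × 3 * a < 2 * (c + μ)
  decode-upper a r e with decode a r _ e
  ... | gen , bounds = gen , ≤ᵇ⇒≤ _ _ (true⇒T (∧-conicalˡ _ _ bounds))
                           , <ᵇ⇒< _ _ (true⇒T (∧-conicalʳ ((c + μ) ≤ᵇ 2 * a) _ bounds))

  unique-in-class : ∀ {a b r} → GeneratorOfClass a r → GeneratorOfClass b r → a ≡ b
  unique-in-class {a} {b} ga gb = minGen-residue-injective S μ μ∈S a b (minGen ga) (minGen gb)
    (trans (residue ga) (sym (residue gb)))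

  class-count-≥ : ∀ g r K → g ∈S S → g % μ ≡ r → (∀ k → k < K → g + k * μ < c) → K ≤ C r
  class-count-≥ g r K g∈S g≡r below = count-progression μ (λ x → mem S x ∧ inClass r x) g K c in-class below
    where
    in-class : ∀ k → k < K → (mem S (g + k * μ) ∧ inClass r (g + k * μ)) ≡ true
    in-class k _ rewrite mem-add S g (k * μ) g∈S (multiple-∈S S μ μ∈S k) =
      T⇒true (≡⇒≡ᵇ _ r (trans ([m+kn]%n≡m%n g k μ) g≡r))

  -- A family P of generators, each with M translates below c, contributes
  -- at most M (it has at most one member) to class r.
  family-bound : ∀ (P : ℕ → Bool) M r →
    (∀ a → (P a ∧ inClass r a) ≡ true → GeneratorOfClass a r × (∀ k → k < M → a + k * μ < c)) →
    M * countBelow (λ a → P a ∧ inClass r a) (c + μ) ≤ C r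
  family-bound P M r members with count-witness (λ a → P a ∧ inClass r a) (c + μ)
  ... | inj₂ none rewrite none | *-zeroʳ M = z≤n
  ... | inj₁ (g , _ , Pg) = begin
    M * countBelow (λ a → P a ∧ inClass r a) (c + μ) ≤⟨ *-monoʳ-≤ M (count-unique _ (c + μ) one) ⟩
    M * 1                                           ≡⟨ *-identityʳ M ⟩
    M                                               ≤⟨ class-count-≥ g r M (minGen-∈S S g (minGen gen)) (residue gen) below ⟩
    C r                                             ∎
    where
    open ≤-Reasoning
    gen : GeneratorOfClass g r
    gen = proj₁ (members g Pg)
    below : ∀ k → k < M → g + k * μ < c
    below = proj₂ (members g Pg)
    one : ∀ x y → x < c + μ → y < c + μ → (P x ∧ inClass r x) ≡ true → (P y ∧ inClass r y) ≡ true → x ≡ y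
    one x y _ _ Px Py = unique-in-class (proj₁ (members x Px)) (proj₁ (members y Py))

  family-avoids-class-0 : ∀ (P : ℕ → Bool) → (∀ a → (P a ∧ inClass 0 a) ≡ true → GeneratorOfClass a 0) →
    countBelow (λ a → P a ∧ inClass 0 a) (c + μ) ≡ 0
  family-avoids-class-0 P members = count-none _ (c + μ) λ a _ Pa →
    let gen = members a Pa in
    minGen-residue-nonzero S μ μ∈S (proj₂ (proj₂ multiplicity)) a (minGen gen) (≢μ gen) (residue gen)

  zero-class-bound : ∀ r → T₀ r ≤ C r
  zero-class-bound zero = class-count-≥ 0 0 (c / μ) (mem-zero S) refl (multiple-below c μ)
  zero-class-bound (suc r) = z≤n

  lower-bound : ∀ r → M₁ * A r ≤ C r
  lower-bound r = family-bound lower M₁ r λ a e →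
    let (gen , small) = decode-lower a r e in
    gen , λ k → progression-below 1 c m a k (subst (2 * a <_) (sym (*-identityˡ (c + μ))) small)

  upper-bound : ∀ r → M₂ * B r ≤ C r
  upper-bound r = family-bound upper M₂ r λ a e →
    let (gen , _ , small) = decode-upper a r e in
    gen , λ k → progression-below 2 c m a k small

  zero-class-exclusive : ∀ r → T₀ r ≡ 0 ⊎ (A r ≡ 0 × B r ≡ 0)
  zero-class-exclusive zero = inj₂ ( family-avoids-class-0 lower (λ a e → proj₁ (decode-lower a 0 e))
                                   , family-avoids-class-0 upper (λ a e → proj₁ (decode-upper a 0 e)))
  zero-class-exclusive (suc r) = inj₁ refl

  -- The generator of a class cannot be both below and above (c+μ)/2.
  lower-upper-exclusive : ∀ r → A r ≡ 0 ⊎ B r ≡ 0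
  lower-upper-exclusive r with count-witness (λ a → lower a ∧ inClass r a) (c + μ)
  ... | inj₂ none = inj₁ none
  ... | inj₁ (g , _ , lg) = inj₂ (count-none _ (c + μ) λ a _ ua →
    let (gen-g , g-small) = decode-lower g r lg
        (gen-a , a-large , _) = decode-upper a r ua
    in <-irrefl refl (≤-<-trans a-large (subst (λ x → 2 * x < c + μ) (unique-in-class gen-g gen-a) g-small)))

  class-bound : ∀ r → T₀ r + M₁ * A r + M₂ * B r ≤ C r
  class-bound r = exclusive-sum-≤ (zero-class-bound r) (lower-bound r) (upper-bound r)
    (Sum.map₂ (λ (A≡0 , B≡0) → scaled M₁ A≡0 , scaled M₂ B≡0) (zero-class-exclusive r))
    (Sum.map (scaled M₁) (scaled M₂) (lower-upper-exclusive r))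
    where
    scaled : ∀ k {x} → x ≡ 0 → k * x ≡ 0
    scaled k refl = *-zeroʳ k

  bound : c / μ + M₁ * q₁ S c μ + M₂ * q₂ S c μ ≤ cardL S c
  bound = begin
    c / μ + M₁ * q₁ S c μ + M₂ * q₂ S c μ
      ≡⟨ cong₂ (λ y z → c / μ + M₁ * y + M₂ * z) (count-by-residue μ lower (c + μ)) (count-by-residue μ upper (c + μ)) ⟩
    c / μ + M₁ * sumBelow A μ + M₂ * sumBelow B μ
      ≡⟨ cong (λ x → x + M₁ * sumBelow A μ + M₂ * sumBelow B μ) (sym (sumBelow-at-zero (c / μ) m)) ⟩
    sumBelow T₀ μ + M₁ * sumBelow A μ + M₂ * sumBelow B μ
      ≡⟨ sym (sumBelow-linear T₀ A B M₁ M₂ μ) ⟩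
    sumBelow (λ r → T₀ r + M₁ * A r + M₂ * B r) μ
      ≤⟨ sumBelow-mono _ _ μ (λ r _ → class-bound r) ⟩
    sumBelow C μ
      ≡⟨ sym (count-by-residue μ (mem S) c) ⟩
    cardL S c ∎
    where open ≤-Reasoning

proposition3p2 : (S : NumericalSemigroup) (c μ : ℕ) →
    IsConductor S c → IsMultiplicity S μ →
    (∀ a → isMinGen S a ≡ true → a ≢ μ → c + μ < 3 * a) →
    (+ cardL S c) ≥ℤ
    ((⌊ + c / μ ⌋
    +ℤ ((⌊ (+ c - + μ) / (2 * μ) ⌋ +ℤ + 1) *ℤ + q₁ S c μ))
    +ℤ ((⌊ (+ c - + (2 * μ)) / (3 * μ) ⌋ +ℤ + 1) *ℤ + q₂ S c μ))
proposition3p2 S c zero _ (μ≢0 , _) _ = ⊥-elim (μ≢0 refl)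
proposition3p2 S c μ@(suc m) _ multiplicity _ = begin
  (⌊ + c / μ ⌋ +ℤ (⌊ (+ c - + μ) / (2 * μ) ⌋ +ℤ + 1) *ℤ + q₁ S c μ)
    +ℤ (⌊ (+ c - + (2 * μ)) / (3 * μ) ⌋ +ℤ + 1) *ℤ + q₂ S c μ
    ≡⟨ cong₂ (λ x y → (+ (c / μ) +ℤ x *ℤ + q₁ S c μ) +ℤ y *ℤ + q₂ S c μ) floor₁ floor₂ ⟩
  (+ (c / μ) +ℤ + M₁ *ℤ + q₁ S c μ) +ℤ + M₂ *ℤ + q₂ S c μ
    ≡⟨ cong₂ (λ x y → (+ (c / μ) +ℤ x) +ℤ y) (sym (pos-* M₁ (q₁ S c μ))) (sym (pos-* M₂ (q₂ S c μ))) ⟩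
  + (c / μ + M₁ * q₁ S c μ + M₂ * q₂ S c μ)
    ≤⟨ +≤+ bound ⟩
  + cardL S c ∎
  where
  open ℤP.≤-Reasoning
  open ResidueClasses S c m multiplicity using (M₁; M₂; bound)
  floor₁ : ⌊ (+ c - + μ) / (2 * μ) ⌋ +ℤ + 1 ≡ + M₁
  floor₁ = trans (floor-minus-plus-one c μ _ (m<m+n μ z<s))
                 (cong (λ z → + ((c + z) / (2 * μ))) (trans (m+n∸m≡n μ (1 * μ)) (*-identityˡ μ)))
  floor₂ : ⌊ (+ c - + (2 * μ)) / (3 * μ) ⌋ +ℤ + 1 ≡ + M₂
  floor₂ = trans (floor-minus-plus-one c (2 * μ) _ (m<n+m (2 * μ) z<s))
                 (cong (λ z → + ((c + z) / (3 * μ))) (m+n∸n≡m μ (2 * μ)))
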